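{- Let $\mathbb{K}$ be a finite field of characteristic different from $2$ and $u\in\mathbb{K}^*$ with $u\notin\{1_{\mathbb{K}},-1_{\mathbb{K}}\}$. (i) If $u^2+4_{\mathbb{K}}$ is not a square in $\mathbb{K}$, then the $u$-trinomial minimal solution of $(E_{\mathbb{K}})$ is irreducible. (ii) Suppose that $u$ or $-u$ is a generator of the cyclic group $\mathbb{K}^*$. Then the $u$-trinomial minimal solution of $(E_{\mathbb{K}})$ is irreducible if and only if $u^2+4_{\mathbb{K}}$ is not a square in $\mathbb{K}$.
   Context: Let $A$ be a commutative unital ring ($0_A\neq 1_A$). For $a_1,\ldots,a_n\in A$ set $M_n(a_1,\ldots,a_n)=\begin{pmatrix} a_n & -1_A\\ 1_A & 0_A\end{pmatrix}\cdots\begin{pmatrix} a_1 & -1_A\\ 1_A & 0_A\end{pmatrix}$. An $n$-tuple is a solution of $(E_A)$ if $M_n(a_1,\ldots,a_n)=\pm \mathrm{Id}$. For tuples, $(a_1,\ldots,a_n)\oplus(b_1,\ldots,b_m)=(a_1+b_m,a_2,\ldots,a_{n-1},a_n+b_1,b_2,\ldots,b_{m-1})$. Write $(a_1,\ldots,a_n)\sim(b_1,\ldots,b_n)$ if $(b_1,\ldots,b_n)$ is obtained from $(a_1,\ldots,a_n)$ or from $(a_n,\ldots,a_1)$ by a cyclic permutation. A solution $(c_1,\ldots,c_n)$ with $n\geq 3$ is reducible if there exist a solution $(b_1,\ldots,b_l)$ and a tuple $(a_1,\ldots,a_m)$ of elements of $A$ with $l,m\geq 3$ and $(c_1,\ldots,c_n)\sim(a_1,\ldots,a_m)\oplus(b_1,\ldots,b_l)$;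 otherwise it is irreducible. For $A$ finite and $u$ a unit of $A$, the $u$-trinomial minimal solution of $(E_A)$ is the solution of the form $(u,u^{ -1},u^{ -1},\ldots,u,u^{ -1},u^{ -1})$ (the block $(u,u^{ -1},u^{ -1})$ repeated $k\geq 1$ times) of minimal size; it exists. $4_{\mathbb{K}}=1_{\mathbb{K}}+1_{\mathbb{K}}+1_{\mathbb{K}}+1_{\mathbb{K}}$. -}

module Defs where

open import Level using (Level; _⊔_)
open import Algebra.Bundles using (CommutativeRing)
open import Data.Nat using (ℕ; zero; suc; _≤_)
open import Data.Fin using (Fin)
open import Data.List using (List; []; _∷_; _++_; [_]; length; drop; take; reverse)
open import Data.List.Relation.Binary.Pointwise using (Pointwise)
open import Data.Product using (Σ; ∃; _×_; _,_)
open import Data.Sum using (_⊎_)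
open import Relation.Nullary using (¬_)

record IsFiniteField {c ℓ : Level} (R : CommutativeRing c ℓ) : Set (c ⊔ ℓ) where
  open CommutativeRing R
  field
    0≉1     : ¬ (0# ≈ 1#)
    inverse : ∀ x → ¬ (x ≈ 0#) → ∃ λ y → x * y ≈ 1#
    finite  : ∃ λ (q : ℕ) → Σ (Fin q → Carrier) λ f → ∀ x → ∃ λ i → f i ≈ x

module FF {c ℓ : Level} (R : CommutativeRing c ℓ) where
  open CommutativeRing R

  record M2 : Set c where
    constructor mat
    field
      m11 m12 m21 m22 : Carrier

  _⊗_ : M2 → M2 → M2
  mat a b c' d ⊗ mat e f g h = mat (a * e + b * g) (a * f + b * h) (c' * e + d * g) (c' * f + d * h)

  IdM : M2
  IdM = mat 1# 0# 0# 1#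

  _≈M_ : M2 → M2 → Set ℓ
  mat a b c' d ≈M mat e f g h = (a ≈ e) × (b ≈ f) × (c' ≈ g) × (d ≈ h)

  negM : M2 → M2
  negM (mat a b c' d) = mat (- a) (- b) (- c') (- d)

  stepM : Carrier → M2
  stepM a = mat a (- 1#) 1# 0#

  -- Mat-acc acc (a_1,...,a_n) = step a_n ⋯ step a_1 · acc
  Mat-acc : M2 → List Carrier → M2
  Mat-acc acc []       = acc
  Mat-acc acc (a ∷ as) = Mat-acc (stepM a ⊗ acc) as

  Mₙ : List Carrier → M2
  Mₙ = Mat-acc IdM

  IsSolution : List Carrier → Set ℓ
  IsSolution as = (Mₙ as ≈M IdM) ⊎ (Mₙ as ≈M negM IdM)

  _≋_ : List Carrier → List Carrier → Set (c ⊔ ℓ)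
  _≋_ = Pointwise _≈_

  rotate : ℕ → List Carrier → List Carrier
  rotate k xs = drop k xs ++ take k xs

  _∼_ : List Carrier → List Carrier → Set (c ⊔ ℓ)
  as ∼ bs = ∃ λ (k : ℕ) → (rotate k as ≋ bs) ⊎ (rotate k (reverse as) ≋ bs)

  ⊕-tuple : Carrier → List Carrier → Carrier → Carrier → List Carrier → Carrier → List Carrier
  ⊕-tuple a₁ amid aₘ b₁ bmid bₗ = (a₁ + bₗ) ∷ amid ++ ((aₘ + b₁) ∷ bmid)

  -- reducible: c ∼ a ⊕ b with b a solution, a arbitrary, both of size ≥ 3
  Reducible : List Carrier → Set (c ⊔ ℓ)
  Reducible cs =
    ∃ λ a₁ → ∃ λ amid → ∃ λ aₘ → ∃ λ b₁ → ∃ λ bmid → ∃ λ bₗ →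
      (1 ≤ length amid) × (1 ≤ length bmid)
      × IsSolution (b₁ ∷ bmid ++ [ bₗ ])
      × (cs ∼ ⊕-tuple a₁ amid aₘ b₁ bmid bₗ)

  Irreducible : List Carrier → Set (c ⊔ ℓ)
  Irreducible cs = ¬ Reducible cs

  -- (u, u⁻¹, u⁻¹) repeated k times, where v plays the role of u⁻¹
  trinomial : Carrier → Carrier → ℕ → List Carrier
  trinomial u v zero    = []
  trinomial u v (suc k) = u ∷ v ∷ v ∷ trinomial u v k

  IsMinimalTrinomial : Carrier → Carrier → ℕ → Set ℓ
  IsMinimalTrinomial u v k =
    (1 ≤ k) × IsSolution (trinomial u v k)
    × (∀ j → 1 ≤ j → IsSolution (trinomial u v j) → k ≤ j)

  four : Carrier
  four = 1# + 1# + 1# + 1#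

  IsSquare : Carrier → Set (c ⊔ ℓ)
  IsSquare x = ∃ λ y → y * y ≈ x

  _^_ : Carrier → ℕ → Carrier
  x ^ zero  = 1#
  x ^ suc n = x * (x ^ n)

  IsGenerator : Carrier → Set (c ⊔ ℓ)
  IsGenerator g = ¬ (g ≈ 0#) × (∀ y → ¬ (y ≈ 0#) → ∃ λ (i : ℕ) → g ^ i ≈ y)

{-# OPTIONS --safe #-}
module Submission where

-- The block (u, v, v) acts by an upper triangular matrix with diagonal (α, β) = (-u, -v), αβ = 1,
-- so (u v v)ʲ is a solution iff αʲ = ±1 (for α ≠ β, i.e. u ≠ ±1). Writing a solution b as
-- (b₁, w, bₗ), its (2,2) entry is -(Mₙ w)₁₁, and conversely any w with (Mₙ w)₁₁ = ±1 extends to a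
-- solution; so (u v v)ᵏ is reducible iff some cyclic window w of length at most 3k - 3 has
-- (Mₙ w)₁₁ = ±1. Reading w block by block, this entry is ±αʲ or ±βʲ with 3j ≤ |w| + 2 (impossible
-- by minimality of k), or 0, or v²βʲ - αʲ; and v²βʲ - αʲ = ±1 makes (2αʲ ± 1)² = 1 + 4v², i.e.
-- u² + 4 a square. Conversely a square root of u² + 4 gives X with X² + X = v²; if ±u generates
-- K*, then X = ±αʲ with j < k, and j ≠ k - 1, so the window v v (u v v)ʲ has (1,1) entry ±1.

open import Defs
open import Level using (_⊔_)
open import Algebra.Bundles using (CommutativeRing)
open import Data.Nat as ℕ using (ℕ; zero; suc; _≤_; _<_; s≤s; z≤n)
import Data.Nat.Properties as ℕ
import Data.Nat.DivMod as ℕ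
open import Data.List using (List; []; _∷_; _++_; [_]; length; drop; take; reverse)
import Data.List.Properties as List
open import Data.List.Relation.Binary.Pointwise as Pointwise using ([]; _∷_)
open import Data.Product using (_×_; _,_; ∃; ∃₂; proj₂)
open import Data.Sum using (_⊎_; inj₁; inj₂)
open import Data.Empty using (⊥-elim)
open import Function.Bundles using (_⇔_; mk⇔)
open import Relation.Nullary using (¬_)
import Relation.Binary.PropositionalEquality as ≡

module IntegerCoefficientSolver {c ℓ} (R : CommutativeRing c ℓ) where

  open import Data.Integer as ℤ using (ℤ; +_; -[1+_]; _⊖_)
  import Data.Integer.Properties as ℤ
  open import Data.Maybe using (Maybe; just; nothing)
  open import Relation.Nullary using (yes; no)
  open import Algebra.Solver.Ring.AlmostCommutativeRing
    using (fromCommutativeRing; _-Raw-AlmostCommutative⟶_)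
  open CommutativeRing R
  open import Algebra.Properties.Semiring.Mult.TCOptimised semiring
    using (×-homo-+; ×1-homo-*; 1+×) renaming (_×_ to _·_)
  open import Algebra.Properties.Ring ring
    using (-‿distribˡ-*; -‿distribʳ-*; -‿involutive; -0#≈0#; -‿+-comm)
  open import Relation.Binary.Reasoning.Setoid setoid

  -- The optimised multiplication makes fromℤ 0 and fromℤ 1 definitionally 0# and 1#,
  -- so that solver constants match the literals in goals.
  fromℤ : ℤ → Carrier
  fromℤ (+ n)      = n · 1#
  fromℤ -[1+ n ]   = - (suc n · 1#)

  1+-cancel : ∀ a b → (1# + a) - (1# + b) ≈ a - b
  1+-cancel a b = begin
    (1# + a) + - (1# + b)     ≈⟨ +-congˡ (-‿+-comm 1# b) ⟨
    (1# + a) + (- 1# + - b)   ≈⟨ interchange 1# a (- 1#) (- b) ⟩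
    (1# - 1#) + (a - b)       ≈⟨ +-congʳ (-‿inverseʳ 1#) ⟩
    0# + (a - b)              ≈⟨ +-identityˡ _ ⟩
    a - b                     ∎
    where open import Algebra.Properties.CommutativeSemigroup +-commutativeSemigroup using (interchange)

  ⊖-homo : ∀ m n → fromℤ (m ⊖ n) ≈ m · 1# - n · 1#
  ⊖-homo zero    zero    = sym (trans (+-congˡ -0#≈0#) (+-identityʳ 0#))
  ⊖-homo zero    (suc n) = sym (+-identityˡ _)
  ⊖-homo (suc m) zero    = sym (trans (+-congˡ -0#≈0#) (+-identityʳ _))
  ⊖-homo (suc m) (suc n) rewrite ℤ.[1+m]⊖[1+n]≡m⊖n m n =
    trans (⊖-homo m n) (sym (trans (+-cong (1+× m 1#) (-‿cong (1+× n 1#))) (1+-cancel (m · 1#) (n · 1#))))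

  +-homo : ∀ i j → fromℤ (i ℤ.+ j) ≈ fromℤ i + fromℤ j
  +-homo (+ m)    (+ n)    = ×-homo-+ 1# m n
  +-homo (+ m)    -[1+ n ] = ⊖-homo m (suc n)
  +-homo -[1+ m ] (+ n)    = trans (⊖-homo n (suc m)) (+-comm _ _)
  +-homo -[1+ m ] -[1+ n ] = begin
    - (suc (suc (m ℕ.+ n)) · 1#)     ≡⟨ ≡.cong (λ k → - (suc k · 1#)) (ℕ.+-suc m n) ⟨
    - ((suc m ℕ.+ suc n) · 1#)       ≈⟨ -‿cong (×-homo-+ 1# (suc m) (suc n)) ⟩
    - (suc m · 1# + suc n · 1#)      ≈⟨ -‿+-comm _ _ ⟨
    - (suc m · 1#) + - (suc n · 1#)  ∎

  *-homo : ∀ i j → fromℤ (i ℤ.* j) ≈ fromℤ i * fromℤ j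
  *-homo (+ zero)    j          = sym (zeroˡ _)
  *-homo (+ suc m)   (+ zero)   rewrite ℕ.*-zeroʳ m = sym (zeroʳ _)
  *-homo -[1+ m ]    (+ zero)   rewrite ℕ.*-zeroʳ m = sym (zeroʳ _)
  *-homo (+ suc m)   (+ suc n)  = ×1-homo-* (suc m) (suc n)
  *-homo (+ suc m)   -[1+ n ]   = trans (-‿cong (×1-homo-* (suc m) (suc n))) (-‿distribʳ-* _ _)
  *-homo -[1+ m ]    (+ suc n)  = trans (-‿cong (×1-homo-* (suc m) (suc n))) (-‿distribˡ-* _ _)
  *-homo -[1+ m ]    -[1+ n ]   = begin
    (suc m ℕ.* suc n) · 1#           ≈⟨ ×1-homo-* (suc m) (suc n) ⟩
    suc m · 1# * suc n · 1#          ≈⟨ -‿involutive _ ⟨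
    - - (suc m · 1# * suc n · 1#)    ≈⟨ -‿cong (-‿distribˡ-* _ _) ⟩
    - (- (suc m · 1#) * suc n · 1#)  ≈⟨ -‿distribʳ-* _ _ ⟩
    - (suc m · 1#) * - (suc n · 1#)  ∎

  -‿homo : ∀ i → fromℤ (ℤ.- i) ≈ - fromℤ i
  -‿homo (+ zero)  = sym -0#≈0#
  -‿homo (+ suc n) = refl
  -‿homo -[1+ n ]  = sym (-‿involutive _)

  fromℤ-homomorphism : ℤ.+-*-rawRing -Raw-AlmostCommutative⟶ fromCommutativeRing R
  fromℤ-homomorphism = record
    { ⟦_⟧    = fromℤ
    ; +-homo = +-homo
    ; *-homo = *-homo
    ; -‿homo = -‿homo
    ; 0-homo = refl
    ; 1-homo = refl
    }

  fromℤ-≟ : ∀ i j → Maybe (fromℤ i ≈ fromℤ j)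
  fromℤ-≟ i j with i ℤ.≟ j
  ... | yes ≡.refl = just refl
  ... | no _     = nothing

  open import Algebra.Solver.Ring ℤ.+-*-rawRing (fromCommutativeRing R) fromℤ-homomorphism fromℤ-≟ public

  0ₚ 1ₚ : ∀ {n} → Polynomial n
  0ₚ = con (+ 0)
  1ₚ = con (+ 1)

module Signs {c ℓ} (R : CommutativeRing c ℓ) where

  open CommutativeRing R
  open FF R using (_^_)
  open import Algebra.Properties.Ring ring using (-‿involutive; -‿distribˡ-*; -‿distribʳ-*; -0#≈0#; -1*x≈-x)
  open import Relation.Binary.Reasoning.Setoid setoid

  infix 4 _≈±_
  _≈±_ : Carrier → Carrier → Set ℓ
  a ≈± b = a ≈ b ⊎ a ≈ - b

  ≈⇒≈± : ∀ {a b} → a ≈ b → a ≈± b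
  ≈⇒≈± = inj₁

  -‿≈± : ∀ a → - a ≈± a
  -‿≈± a = inj₂ refl

  ≈±-sym : ∀ {a b} → a ≈± b → b ≈± a
  ≈±-sym (inj₁ a≈b)  = inj₁ (sym a≈b)
  ≈±-sym (inj₂ a≈-b) = inj₂ (trans (sym (-‿involutive _)) (-‿cong (sym a≈-b)))

  ≈±-trans : ∀ {a b d} → a ≈± b → b ≈± d → a ≈± d
  ≈±-trans (inj₁ p) (inj₁ q) = inj₁ (trans p q)
  ≈±-trans (inj₁ p) (inj₂ q) = inj₂ (trans p q)
  ≈±-trans (inj₂ p) (inj₁ q) = inj₂ (trans p (-‿cong q))
  ≈±-trans (inj₂ p) (inj₂ q) = inj₁ (trans p (trans (-‿cong q) (-‿involutive _)))

  ≈±-*-congˡ : ∀ d {a b} → a ≈± b → d * a ≈± d * b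
  ≈±-*-congˡ d (inj₁ a≈b)  = inj₁ (*-congˡ a≈b)
  ≈±-*-congˡ d (inj₂ a≈-b) = inj₂ (trans (*-congˡ a≈-b) (sym (-‿distribʳ-* d _)))

  ≈±1⇒*-self≈1 : ∀ {a} → a ≈± 1# → a * a ≈ 1#
  ≈±1⇒*-self≈1 (inj₁ a≈1)  = trans (*-cong a≈1 a≈1) (*-identityʳ 1#)
  ≈±1⇒*-self≈1 (inj₂ a≈-1) = begin
    _ * _         ≈⟨ *-cong a≈-1 a≈-1 ⟩
    - 1# * - 1#   ≈⟨ -1*x≈-x (- 1#) ⟩
    - - 1#        ≈⟨ -‿involutive 1# ⟩
    1#            ∎

  *-inverse-unique : ∀ {a b b'} → a * b ≈ 1# → a * b' ≈ 1# → b ≈ b'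
  *-inverse-unique {a} {b} {b'} ab≈1 ab'≈1 = begin
    b               ≈⟨ *-identityʳ b ⟨
    b * 1#          ≈⟨ *-congˡ ab'≈1 ⟨
    b * (a * b')    ≈⟨ *-assoc b a b' ⟨
    (b * a) * b'    ≈⟨ *-congʳ (trans (*-comm b a) ab≈1) ⟩
    1# * b'         ≈⟨ *-identityˡ b' ⟩
    b'              ∎

  ≈±1-inverse : ∀ {a b} → a * b ≈ 1# → a ≈± 1# → b ≈ a
  ≈±1-inverse ab≈1 a≈±1 = *-inverse-unique ab≈1 (≈±1⇒*-self≈1 a≈±1)

  -- Identities modulo relations e ≈ e': the solver checks a ≈ b + (e - e') * k for an explicit k.
  ≈-modulo : ∀ {a b e e'} k → e ≈ e' → a ≈ b + (e - e') * k → a ≈ b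
  ≈-modulo {a} {b} {e} {e'} k e≈e' a≈ = begin
    a                   ≈⟨ a≈ ⟩
    b + (e - e') * k    ≈⟨ +-congˡ (*-congʳ (trans (+-congʳ e≈e') (-‿inverseʳ e'))) ⟩
    b + 0# * k          ≈⟨ +-congˡ (zeroˡ k) ⟩
    b + 0#              ≈⟨ +-identityʳ b ⟩
    b                   ∎

  0≉±1 : ¬ 0# ≈ 1# → ¬ 0# ≈± 1#
  0≉±1 0≉1 (inj₁ 0≈1)  = 0≉1 0≈1
  0≉±1 0≉1 (inj₂ 0≈-1) = 0≉1 (begin
    0#       ≈⟨ -0#≈0# ⟨
    - 0#     ≈⟨ -‿cong 0≈-1 ⟩
    - - 1#   ≈⟨ -‿involutive 1# ⟩
    1#       ∎)

  ^-+ : ∀ a m n → a ^ (m ℕ.+ n) ≈ a ^ m * a ^ n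
  ^-+ a zero    n = sym (*-identityˡ _)
  ^-+ a (suc m) n = trans (*-congˡ (^-+ a m n)) (sym (*-assoc a _ _))

  ^-inverse : ∀ {a b} → a * b ≈ 1# → ∀ n → a ^ n * b ^ n ≈ 1#
  ^-inverse ab≈1 zero    = *-identityʳ 1#
  ^-inverse {a} {b} ab≈1 (suc n) = begin
    (a * a ^ n) * (b * b ^ n)   ≈⟨ *-assoc a _ _ ⟩
    a * (a ^ n * (b * b ^ n))   ≈⟨ *-congˡ (x∙yz≈y∙xz (a ^ n) b (b ^ n)) ⟩
    a * (b * (a ^ n * b ^ n))   ≈⟨ *-assoc a b _ ⟨
    (a * b) * (a ^ n * b ^ n)   ≈⟨ *-cong ab≈1 (^-inverse ab≈1 n) ⟩
    1# * 1#                     ≈⟨ *-identityʳ 1# ⟩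
    1#                          ∎
    where open import Algebra.Properties.CommutativeSemigroup *-commutativeSemigroup using (x∙yz≈y∙xz)

  -^≈±^ : ∀ a n → (- a) ^ n ≈± a ^ n
  -^≈±^ a zero    = inj₁ refl
  -^≈±^ a (suc n) =
    ≈±-trans (≈±-*-congˡ (- a) (-^≈±^ a n))
      (≈±-trans (≈⇒≈± (sym (-‿distribˡ-* a _))) (-‿≈± _))

  ^-*-≈±1 : ∀ {a} k → a ^ k ≈± 1# → ∀ q → a ^ (q ℕ.* k) ≈± 1#
  ^-*-≈±1 k aᵏ≈±1 zero    = inj₁ refl
  ^-*-≈±1 {a} k aᵏ≈±1 (suc q) =
    ≈±-trans (≈⇒≈± (^-+ a k (q ℕ.* k)))
      (≈±-trans (≈±-*-congˡ (a ^ k) (^-*-≈±1 k aᵏ≈±1 q))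
        (≈±-trans (≈⇒≈± (*-identityʳ _)) aᵏ≈±1))

  ^-%-≈± : ∀ {a} k .{{_ : ℕ.NonZero k}} → a ^ k ≈± 1# → ∀ i → a ^ (i ℕ.% k) ≈± a ^ i
  ^-%-≈± {a} k aᵏ≈±1 i = ≈±-sym (≈±-trans (≈⇒≈± (begin
    a ^ i                                     ≡⟨ ≡.cong (a ^_) (ℕ.m≡m%n+[m/n]*n i k) ⟩
    a ^ (i ℕ.% k ℕ.+ (i ℕ./ k) ℕ.* k)         ≈⟨ ^-+ a (i ℕ.% k) _ ⟩
    a ^ (i ℕ.% k) * a ^ ((i ℕ./ k) ℕ.* k)     ∎))
    (≈±-trans (≈±-*-congˡ (a ^ (i ℕ.% k)) (^-*-≈±1 k aᵏ≈±1 (i ℕ./ k))) (≈⇒≈± (*-identityʳ _))))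

module Matrices {c ℓ} (R : CommutativeRing c ℓ) where

  open CommutativeRing R
  open FF R
  open M2 using (m11; m12; m21; m22)
  open Signs R
  open IntegerCoefficientSolver R using (solve; _:=_; _:+_; _:*_; :-_; _:-_; 0ₚ; 1ₚ)
  open import Algebra.Properties.Ring ring using (-0#≈0#; -‿distribˡ-*)
  open import Relation.Binary.Reasoning.Setoid setoid

  ≈M-refl : ∀ {A} → A ≈M A
  ≈M-refl = refl , refl , refl , refl

  ≈M-sym : ∀ {A B} → A ≈M B → B ≈M A
  ≈M-sym (p , q , r , s) = sym p , sym q , sym r , sym s

  ≈M-trans : ∀ {A B C} → A ≈M B → B ≈M C → A ≈M C
  ≈M-trans (p , q , r , s) (p' , q' , r' , s') = trans p p' , trans q q' , trans r r' , trans s s'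

  ⊗-cong : ∀ {A A' B B'} → A ≈M A' → B ≈M B' → (A ⊗ B) ≈M (A' ⊗ B')
  ⊗-cong (a , b , c , d) (e , f , g , h) =
    +-cong (*-cong a e) (*-cong b g) , +-cong (*-cong a f) (*-cong b h) ,
    +-cong (*-cong c e) (*-cong d g) , +-cong (*-cong c f) (*-cong d h)

  ⊗-assoc : ∀ A B C → ((A ⊗ B) ⊗ C) ≈M (A ⊗ (B ⊗ C))
  ⊗-assoc (mat a b c d) (mat e f g h) (mat i j k l) =
    row a b e f g h i k , row a b e f g h j l , row c d e f g h i k , row c d e f g h j l
    where
    row : ∀ a b e f g h i k → (a * e + b * g) * i + (a * f + b * h) * k ≈ a * (e * i + f * k) + b * (g * i + h * k)
    row = solve 8 (λ a b e f g h i k →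
      (a :* e :+ b :* g) :* i :+ (a :* f :+ b :* h) :* k := a :* (e :* i :+ f :* k) :+ b :* (g :* i :+ h :* k)) refl

  ⊗-identityˡ : ∀ A → (IdM ⊗ A) ≈M A
  ⊗-identityˡ (mat a b c d) = unitˡ a c , unitˡ b d , unitʳ a c , unitʳ b d
    where
    unitˡ : ∀ x y → 1# * x + 0# * y ≈ x
    unitˡ = solve 2 (λ x y → 1ₚ :* x :+ 0ₚ :* y := x) refl
    unitʳ : ∀ x y → 0# * x + 1# * y ≈ y
    unitʳ = solve 2 (λ x y → 0ₚ :* x :+ 1ₚ :* y := y) refl

  ⊗-identityʳ : ∀ A → (A ⊗ IdM) ≈M A
  ⊗-identityʳ (mat a b c d) = unitˡ a b , unitʳ a b , unitˡ c d , unitʳ c d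
    where
    unitˡ : ∀ x y → x * 1# + y * 0# ≈ x
    unitˡ = solve 2 (λ x y → x :* 1ₚ :+ y :* 0ₚ := x) refl
    unitʳ : ∀ x y → x * 0# + y * 1# ≈ y
    unitʳ = solve 2 (λ x y → x :* 0ₚ :+ y :* 1ₚ := y) refl

  Mat-acc-cong : ∀ w {A B} → A ≈M B → Mat-acc A w ≈M Mat-acc B w
  Mat-acc-cong []      A≈B = A≈B
  Mat-acc-cong (x ∷ w) A≈B = Mat-acc-cong w (⊗-cong ≈M-refl A≈B)

  Mat-acc-⊗ : ∀ w A B → Mat-acc (A ⊗ B) w ≈M (Mat-acc A w ⊗ B)
  Mat-acc-⊗ []      A B = ≈M-refl
  Mat-acc-⊗ (x ∷ w) A B =
    ≈M-trans (Mat-acc-cong w (≈M-sym (⊗-assoc (stepM x) A B))) (Mat-acc-⊗ w (stepM x ⊗ A) B)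

  Mat-acc≈Mₙ⊗ : ∀ w A → Mat-acc A w ≈M (Mₙ w ⊗ A)
  Mat-acc≈Mₙ⊗ w A = ≈M-trans (Mat-acc-cong w (≈M-sym (⊗-identityˡ A))) (Mat-acc-⊗ w IdM A)

  Mat-acc-++ : ∀ A w w' → Mat-acc A (w ++ w') ≡.≡ Mat-acc (Mat-acc A w) w'
  Mat-acc-++ A []      w' = ≡.refl
  Mat-acc-++ A (x ∷ w) w' = Mat-acc-++ (stepM x ⊗ A) w w'

  Mₙ-++ : ∀ w w' → Mₙ (w ++ w') ≈M (Mₙ w' ⊗ Mₙ w)
  Mₙ-++ w w' rewrite Mat-acc-++ IdM w w' = Mat-acc≈Mₙ⊗ w' (Mₙ w)

  Mₙ-[x] : ∀ x → Mₙ [ x ] ≈M stepM x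
  Mₙ-[x] x = ⊗-identityʳ (stepM x)

  Mₙ-wrap : ∀ x w y → Mₙ (x ∷ w ++ [ y ]) ≈M (stepM y ⊗ (Mₙ w ⊗ stepM x))
  Mₙ-wrap x w y =
    ≈M-trans (Mₙ-++ (x ∷ w) [ y ])
      (⊗-cong (Mₙ-[x] y) (≈M-trans (Mₙ-++ [ x ] w) (⊗-cong ≈M-refl (Mₙ-[x] x))))

  det : M2 → Carrier
  det (mat a b c d) = a * d - b * c

  det-stepM-⊗ : ∀ x A → det (stepM x ⊗ A) ≈ det A
  det-stepM-⊗ x (mat a b c d) = solve 5 (λ x a b c d →
    (x :* a :+ (:- 1ₚ) :* c) :* (1ₚ :* b :+ 0ₚ :* d)
      :- (x :* b :+ (:- 1ₚ) :* d) :* (1ₚ :* a :+ 0ₚ :* c)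
    := a :* d :- b :* c) refl x a b c d

  det-Mat-acc : ∀ w A → det (Mat-acc A w) ≈ det A
  det-Mat-acc []      A = refl
  det-Mat-acc (x ∷ w) A = trans (det-Mat-acc w (stepM x ⊗ A)) (det-stepM-⊗ x A)

  det-Mₙ : ∀ w → det (Mₙ w) ≈ 1#
  det-Mₙ w = trans (det-Mat-acc w IdM)
    (solve 0 (1ₚ :* 1ₚ :- 0ₚ :* 0ₚ := 1ₚ) refl)

  det≈1⇒m11*m22≈1 : ∀ {A} → det A ≈ 1# → m21 A ≈ 0# → m11 A * m22 A ≈ 1#
  det≈1⇒m11*m22≈1 {A} det≈1 m21≈0 = begin
    m11 A * m22 A                   ≈⟨ solve 3 (λ a b d → a :* d := a :* d :- b :* 0ₚ) refl _ (m12 A) _ ⟩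
    m11 A * m22 A - m12 A * 0#      ≈⟨ +-congˡ (-‿cong (*-congˡ m21≈0)) ⟨
    m11 A * m22 A - m12 A * m21 A   ≈⟨ det≈1 ⟩
    1#                              ∎

  IsSolution⇒m11≈±1 : ∀ w → IsSolution w → m11 (Mₙ w) ≈± 1#
  IsSolution⇒m11≈±1 w (inj₁ (m11≈1 , _))  = inj₁ m11≈1
  IsSolution⇒m11≈±1 w (inj₂ (m11≈-1 , _)) = inj₂ m11≈-1

  IsSolution⇒m22≈±1 : ∀ w → IsSolution w → m22 (Mₙ w) ≈± 1#
  IsSolution⇒m22≈±1 w (inj₁ (_ , _ , _ , m22≈1))  = inj₁ m22≈1
  IsSolution⇒m22≈±1 w (inj₂ (_ , _ , _ , m22≈-1)) = inj₂ m22≈-1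

  scalar⇒IsSolution : ∀ w {e} → Mₙ w ≈M mat e 0# 0# e → e ≈± 1# → IsSolution w
  scalar⇒IsSolution w Mₙw≈e (inj₁ e≈1)  = inj₁ (≈M-trans Mₙw≈e (e≈1 , refl , refl , e≈1))
  scalar⇒IsSolution w Mₙw≈e (inj₂ e≈-1) = inj₂ (≈M-trans Mₙw≈e (e≈-1 , 0≈-0 , 0≈-0 , e≈-1))
    where 0≈-0 = sym -0#≈0#

  -- Whatever x and y are, the (2,2) entry of Mₙ (x ∷ w ++ [ y ]) is -(Mₙ w)₁₁.
  solution⇒corner≈±1 : ∀ x w y → IsSolution (x ∷ w ++ [ y ]) → m11 (Mₙ w) ≈± 1#
  solution⇒corner≈±1 x w y sol =
    ≈±-trans (≈±-sym (-‿≈± _)) (≈±-trans (≈⇒≈± (sym m22≈-m11)) (IsSolution⇒m22≈±1 (x ∷ w ++ [ y ]) sol))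
    where
    N = Mₙ w
    m22≈-m11 : m22 (Mₙ (x ∷ w ++ [ y ])) ≈ - m11 N
    m22≈-m11 = trans (proj₂ (proj₂ (proj₂ (Mₙ-wrap x w y)))) (solve 4 (λ p q r s →
      1ₚ :* (p :* (:- 1ₚ) :+ q :* 0ₚ) :+ 0ₚ :* (r :* (:- 1ₚ) :+ s :* 0ₚ)
      := :- p) refl (m11 N) (m12 N) (m21 N) (m22 N))

  sandwich : ∀ p q r s → p * p ≈ 1# → p * s - q * r ≈ 1# →
    (stepM (p * r) ⊗ (mat p q r s ⊗ stepM (- (p * q)))) ≈M mat (- p) 0# 0# (- p)
  sandwich p q r s p²≈1 det≈1 =
    ≈-modulo (s - p * q * r) p²≈1 (≈-modulo (- p) det≈1 (solve 4 (λ p q r s →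
      (p :* r) :* (p :* (:- (p :* q)) :+ q :* 1ₚ) :+ (:- 1ₚ) :* (r :* (:- (p :* q)) :+ s :* 1ₚ)
      := (:- p :+ (p :* p :- 1ₚ) :* (s :- p :* q :* r)) :+ ((p :* s :- q :* r) :- 1ₚ) :* (:- p)) refl p q r s)) ,
    ≈-modulo (- r) p²≈1 (solve 4 (λ p q r s →
      (p :* r) :* (p :* (:- 1ₚ) :+ q :* 0ₚ) :+ (:- 1ₚ) :* (r :* (:- 1ₚ) :+ s :* 0ₚ)
      := 0ₚ :+ (p :* p :- 1ₚ) :* (:- r)) refl p q r s) ,
    ≈-modulo (- q) p²≈1 (solve 4 (λ p q r s →
      1ₚ :* (p :* (:- (p :* q)) :+ q :* 1ₚ) :+ 0ₚ :* (r :* (:- (p :* q)) :+ s :* 1ₚ)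
      := 0ₚ :+ (p :* p :- 1ₚ) :* (:- q)) refl p q r s) ,
    solve 4 (λ p q r s → 1ₚ :* (p :* (:- 1ₚ) :+ q :* 0ₚ) :+ 0ₚ :* (r :* (:- 1ₚ) :+ s :* 0ₚ) := :- p)
      refl p q r s

  corner≈±1⇒solution : ∀ w → let N = Mₙ w in m11 N ≈± 1# →
    IsSolution (- (m11 N * m12 N) ∷ w ++ [ m11 N * m21 N ])
  corner≈±1⇒solution w corner = scalar⇒IsSolution (_ ∷ w ++ [ _ ])
    (≈M-trans (Mₙ-wrap _ w _) (sandwich _ _ _ _ (≈±1⇒*-self≈1 corner) (det-Mₙ w)))
    (≈±-trans (-‿≈± _) corner)

  record FirstColumn (A : M2) (a b : Carrier) : Set ℓ where
    constructor column
    field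
      m11≈ : m11 A ≈ a
      m21≈ : m21 A ≈ b
  open FirstColumn public

  FirstColumn-cong : ∀ {A a b a' b'} → FirstColumn A a b → a ≈ a' → b ≈ b' → FirstColumn A a' b'
  FirstColumn-cong (column m11≈a m21≈b) a≈a' b≈b' = column (trans m11≈a a≈a') (trans m21≈b b≈b')

  stepM-firstColumn : ∀ {A a b x x'} → x ≈ x' → FirstColumn A a b → FirstColumn (stepM x ⊗ A) (x' * a - b) a
  stepM-firstColumn {A} {a} {b} {x} {x'} x≈x' (column m11≈a m21≈b) = column
    (trans (+-cong (*-cong x≈x' m11≈a) (*-congˡ m21≈b))
           (solve 3 (λ x a b → x :* a :+ (:- 1ₚ) :* b := x :* a :- b) refl x' a b))
    (trans (+-cong (*-congˡ m11≈a) (*-congˡ m21≈b)) (solve 2 (λ a b → 1ₚ :* a :+ 0ₚ :* b := a) refl a b))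

  stepM-firstColumn₀ : ∀ {A X x x'} → x ≈ x' → FirstColumn A X 0# → FirstColumn (stepM x ⊗ A) (x' * X) X
  stepM-firstColumn₀ {X = X} {x' = x'} x≈x' col =
    FirstColumn-cong (stepM-firstColumn x≈x' col) (solve 2 (λ x X → x :* X :- 0ₚ := x :* X) refl x' X) refl

  inverse-pair-firstColumn : ∀ {A X x y x' y'} → x ≈ x' → y ≈ y' → x' * y' ≈ 1# → FirstColumn A X 0# →
    FirstColumn (stepM y ⊗ (stepM x ⊗ A)) 0# (x' * X)
  inverse-pair-firstColumn {X = X} {x' = x'} {y'} x≈x' y≈y' x'y'≈1 col =
    FirstColumn-cong (stepM-firstColumn y≈y' (stepM-firstColumn₀ x≈x' col))
      (≈-modulo X x'y'≈1 (solve 3 (λ x y X → y :* (x :* X) :- X := 0ₚ :+ (x :* y :- 1ₚ) :* X) refl x' y' X))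
      refl

  zero-top-firstColumn : ∀ {A b z} → FirstColumn A 0# b → FirstColumn (stepM z ⊗ A) (- b) 0#
  zero-top-firstColumn {b = b} {z} col =
    FirstColumn-cong (stepM-firstColumn refl col) (solve 2 (λ z b → z :* 0ₚ :- b := :- b) refl z b) refl

  inverse-pair-block : ∀ {A X x y z x' y'} → x ≈ x' → y ≈ y' → x' * y' ≈ 1# → FirstColumn A X 0# →
    FirstColumn (stepM z ⊗ (stepM y ⊗ (stepM x ⊗ A))) (- x' * X) 0#
  inverse-pair-block {X = X} {x' = x'} x≈x' y≈y' x'y'≈1 col =
    FirstColumn-cong (zero-top-firstColumn (inverse-pair-firstColumn x≈x' y≈y' x'y'≈1 col))
      (-‿distribˡ-* x' X) refl

module Rotations {c ℓ} (R : CommutativeRing c ℓ) where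

  open FF R

  length-rotate : ∀ n xs → length (rotate n xs) ≡.≡ length xs
  length-rotate n xs = ≡.trans (List.length-++-comm (drop n xs) (take n xs)) (≡.cong length (List.take++drop≡id n xs))

  ∼-length : ∀ {as bs} → as ∼ bs → length bs ≡.≡ length as
  ∼-length {as} (n , inj₁ rotate≋) = ≡.trans (≡.sym (Pointwise.Pointwise-length rotate≋)) (length-rotate n as)
  ∼-length {as} (n , inj₂ rotate≋) = ≡.trans (≡.sym (Pointwise.Pointwise-length rotate≋))
    (≡.trans (length-rotate n (reverse as)) (List.length-reverse as))

module Trinomials {c ℓ} (R : CommutativeRing c ℓ) {u v : CommutativeRing.Carrier R}
                  (uv≈1 : CommutativeRing._≈_ R (CommutativeRing._*_ R u v) (CommutativeRing.1# R)) where

  open CommutativeRing R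
  open FF R
  open M2 using (m11; m12; m21; m22)
  open Signs R
  open Matrices R
  open Rotations R
  open IntegerCoefficientSolver R using (solve; _:=_; _:+_; _:*_; :-_; _:-_; 0ₚ; 1ₚ)
  open import Algebra.Properties.Ring ring using (-‿distribˡ-*)

  α β : Carrier
  α = - u
  β = - v

  αβ≈1 : α * β ≈ 1#
  αβ≈1 = trans (solve 2 (λ u v → (:- u) :* (:- v) := u :* v) refl u v) uv≈1

  αX-βY-inverse : ∀ {X Y} → X * Y ≈ 1# → (α * X) * (β * Y) ≈ 1#
  αX-βY-inverse {X} {Y} XY≈1 =
    trans (solve 4 (λ a b X Y → (a :* X) :* (b :* Y) := (a :* b) :* (X :* Y)) refl α β X Y)
          (trans (*-cong αβ≈1 XY≈1) (*-identityʳ 1#))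

  data Position : Set where
    first second third : Position

  next : Position → Position
  next first  = second
  next second = third
  next third  = first

  letter : Position → Carrier
  letter first  = u
  letter second = v
  letter third  = v

  -- Periodic s e w: w is a factor of u v v u v v … read from position s, ending before position e.
  data Periodic : Position → Position → List Carrier → Set (c ⊔ ℓ) where
    []  : ∀ {s} → Periodic s s []
    _∷_ : ∀ {s e x w} → x ≈ letter s → Periodic (next s) e w → Periodic s e (x ∷ w)

  -- Reading whole blocks from position s multiplies (X, Y) by (α, β); from the identity matrix
  -- this is the first column after q blocks, with X = αᵠ and Y = βᵠ.
  BlockColumn : Position → Carrier → Carrier → M2 → Set ℓ
  BlockColumn first  X Y A = FirstColumn A X 0#
  BlockColumn second X Y A = FirstColumn A X (v * (X - Y))
  BlockColumn third  X Y A = FirstColumn A Y 0#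

  BlockColumn-start : ∀ s → BlockColumn s 1# 1# IdM
  BlockColumn-start first  = column refl refl
  BlockColumn-start second = column refl (solve 1 (λ v → 0ₚ := v :* (1ₚ :- 1ₚ)) refl v)
  BlockColumn-start third  = column refl refl

  second-one-letter : ∀ {A X Y x} → x ≈ v → BlockColumn second X Y A → FirstColumn (stepM x ⊗ A) (v * Y) X
  second-one-letter {X = X} {Y} x≈v col =
    FirstColumn-cong (stepM-firstColumn x≈v col)
      (solve 3 (λ v X Y → v :* X :- v :* (X :- Y) := v :* Y) refl v X Y) refl

  second-two-letters : ∀ {A X Y x y} → x ≈ v → y ≈ v → BlockColumn second X Y A →
    FirstColumn (stepM y ⊗ (stepM x ⊗ A)) (v * (v * Y) - X) (v * Y)
  second-two-letters x≈v y≈v col = stepM-firstColumn y≈v (second-one-letter x≈v col)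

  blockColumn-step : ∀ {s e x y z X Y A} → Periodic s e (x ∷ y ∷ z ∷ []) → BlockColumn s X Y A →
    BlockColumn e (α * X) (β * Y) (stepM z ⊗ (stepM y ⊗ (stepM x ⊗ A)))
  blockColumn-step {first}  (x≈u ∷ y≈v ∷ _ ∷ []) col = inverse-pair-block x≈u y≈v uv≈1 col
  blockColumn-step {third}  (x≈v ∷ y≈u ∷ _ ∷ []) col = inverse-pair-block x≈v y≈u (trans (*-comm v u) uv≈1) col
  blockColumn-step {second} {X = X} {Y} (x≈v ∷ y≈v ∷ z≈u ∷ []) col =
    FirstColumn-cong (stepM-firstColumn z≈u (second-two-letters x≈v y≈v col))
      (≈-modulo (v * Y) uv≈1 (solve 4 (λ u v X Y →
         u :* (v :* (v :* Y) :- X) :- v :* Y := (:- u) :* X :+ (u :* v :- 1ₚ) :* (v :* Y)) refl u v X Y))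
      (≈-modulo X uv≈1 (solve 4 (λ u v X Y →
         v :* (v :* Y) :- X := v :* ((:- u) :* X :- (:- v) :* Y) :+ (u :* v :- 1ₚ) :* X) refl u v X Y))

  blockColumn-m11 : ∀ {s X Y A} → X * Y ≈ 1# → BlockColumn s X Y A → m11 A ≈± 1# → X ≈± 1#
  blockColumn-m11 {first}  XY≈1 col m11≈±1 = ≈±-trans (≈⇒≈± (sym (m11≈ col))) m11≈±1
  blockColumn-m11 {second} XY≈1 col m11≈±1 = ≈±-trans (≈⇒≈± (sym (m11≈ col))) m11≈±1
  blockColumn-m11 {third}  XY≈1 col m11≈±1 =
    ≈±-trans (≈⇒≈± (≈±1-inverse (trans (*-comm _ _) XY≈1) Y≈±1)) Y≈±1
    where Y≈±1 = ≈±-trans (≈⇒≈± (sym (m11≈ col))) m11≈±1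

  βY≈±1⇒αX≈±1 : ∀ {X Y} → X * Y ≈ 1# → β * Y ≈± 1# → α * X ≈± 1#
  βY≈±1⇒αX≈±1 XY≈1 βY≈±1 =
    ≈±-trans (≈⇒≈± (≈±1-inverse (trans (*-comm _ _) (αX-βY-inverse XY≈1)) βY≈±1)) βY≈±1

  negate-≈±1 : ∀ {a x X} → a ≈ x * X → a ≈± 1# → - x * X ≈± 1#
  negate-≈±1 {x = x} {X} a≈xX a≈±1 =
    ≈±-trans (≈⇒≈± (sym (-‿distribˡ-* x X))) (≈±-trans (-‿≈± _) (≈±-trans (≈⇒≈± (sym a≈xX)) a≈±1))

  corner≈±1-after-one-letter : ∀ {s e x X Y A} → Periodic s e (x ∷ []) → X * Y ≈ 1# → BlockColumn s X Y A →
    m11 (stepM x ⊗ A) ≈± 1# → α * X ≈± 1#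
  corner≈±1-after-one-letter {first}  (x≈u ∷ []) XY≈1 col m11≈±1 =
    negate-≈±1 (m11≈ (stepM-firstColumn₀ x≈u col)) m11≈±1
  corner≈±1-after-one-letter {second} (x≈v ∷ []) XY≈1 col m11≈±1 =
    βY≈±1⇒αX≈±1 XY≈1 (negate-≈±1 (m11≈ (second-one-letter x≈v col)) m11≈±1)
  corner≈±1-after-one-letter {third}  (x≈v ∷ []) XY≈1 col m11≈±1 =
    βY≈±1⇒αX≈±1 XY≈1 (negate-≈±1 (m11≈ (stepM-firstColumn₀ x≈v col)) m11≈±1)

  -- (X + v²Y)² = (v²Y - X)² + 4v²·XY, and u²·4v² = 4 when uv = 1.
  square-from-corner : ∀ {X Y} → X * Y ≈ 1# → v * (v * Y) - X ≈± 1# → IsSquare (u * u + four)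
  square-from-corner {X} {Y} XY≈1 corner = u * (X + v * (v * Y)) ,
    ≈-modulo (u * u) (≈±1⇒*-self≈1 corner) (≈-modulo (four * (u * u * (v * v))) XY≈1
      (≈-modulo (four * (u * v + 1#)) uv≈1 (solve 4 (λ u v X Y →
        (u :* (X :+ v :* (v :* Y))) :* (u :* (X :+ v :* (v :* Y)))
        := (((u :* u :+ (1ₚ :+ 1ₚ :+ 1ₚ :+ 1ₚ))
              :+ ((v :* (v :* Y) :- X) :* (v :* (v :* Y) :- X) :- 1ₚ) :* (u :* u))
              :+ (X :* Y :- 1ₚ) :* ((1ₚ :+ 1ₚ :+ 1ₚ :+ 1ₚ) :* (u :* u :* (v :* v))))
              :+ (u :* v :- 1ₚ) :* ((1ₚ :+ 1ₚ :+ 1ₚ :+ 1ₚ) :* (u :* v :+ 1ₚ))) refl u v X Y)))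

  corner≈±1-after-two-letters : ¬ 0# ≈ 1# → ∀ {s e x y X Y A} → Periodic s e (x ∷ y ∷ []) → X * Y ≈ 1# →
    BlockColumn s X Y A → m11 (stepM y ⊗ (stepM x ⊗ A)) ≈± 1# → IsSquare (u * u + four)
  corner≈±1-after-two-letters 0≉1 {first} (x≈u ∷ y≈v ∷ []) XY≈1 col m11≈±1 =
    ⊥-elim (0≉±1 0≉1 (≈±-trans (≈⇒≈± (sym (m11≈ (inverse-pair-firstColumn x≈u y≈v uv≈1 col)))) m11≈±1))
  corner≈±1-after-two-letters 0≉1 {second} (x≈v ∷ y≈v ∷ []) XY≈1 col m11≈±1 =
    square-from-corner XY≈1 (≈±-trans (≈⇒≈± (sym (m11≈ (second-two-letters x≈v y≈v col)))) m11≈±1)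
  corner≈±1-after-two-letters 0≉1 {third} (x≈v ∷ y≈u ∷ []) XY≈1 col m11≈±1 =
    ⊥-elim (0≉±1 0≉1 (≈±-trans (≈⇒≈± (sym (m11≈ (inverse-pair-firstColumn x≈v y≈u vu≈1 col)))) m11≈±1))
    where vu≈1 = trans (*-comm v u) uv≈1

  WindowOutcome : ℕ → Carrier → Set (c ⊔ ℓ)
  WindowOutcome L X = (∃ λ j → 1 ≤ j × 3 ℕ.* j ≤ L ℕ.+ 2 × α ^ j * X ≈± 1#) ⊎ IsSquare (u * u + four)

  α¹ : ∀ X → α ^ 1 * X ≈ α * X
  α¹ X = *-congʳ (*-identityʳ α)

  WindowOutcome-block : ∀ {L X} → WindowOutcome L (α * X) → WindowOutcome (3 ℕ.+ L) X
  WindowOutcome-block {L} {X} (inj₁ (j , 1≤j , 3j≤L+2 , αʲαX≈±1)) = inj₁ (suc j , s≤s z≤n ,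
    ≡.subst (ℕ._≤ 3 ℕ.+ L ℕ.+ 2) (≡.sym (ℕ.*-suc 3 j)) (ℕ.+-monoʳ-≤ 3 3j≤L+2) ,
    ≈±-trans (≈⇒≈± (solve 3 (λ a p X → (a :* p) :* X := p :* (a :* X)) refl α (α ^ j) X)) αʲαX≈±1)
  WindowOutcome-block (inj₂ square) = inj₂ square

  corner≈±1⇒WindowOutcome : ¬ 0# ≈ 1# → ∀ {s e x w X Y A} → Periodic s e (x ∷ w) → X * Y ≈ 1# → BlockColumn s X Y A →
    m11 (Mat-acc A (x ∷ w)) ≈± 1# → WindowOutcome (length (x ∷ w)) X
  corner≈±1⇒WindowOutcome 0≉1 {X = X} p@(_ ∷ []) XY≈1 col m11≈±1 =
    inj₁ (1 , ℕ.≤-refl , ℕ.≤-refl , ≈±-trans (≈⇒≈± (α¹ X)) (corner≈±1-after-one-letter p XY≈1 col m11≈±1))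
  corner≈±1⇒WindowOutcome 0≉1 p@(_ ∷ _ ∷ []) XY≈1 col m11≈±1 =
    inj₂ (corner≈±1-after-two-letters 0≉1 p XY≈1 col m11≈±1)
  corner≈±1⇒WindowOutcome 0≉1 {X = X} p@(_ ∷ _ ∷ _ ∷ []) XY≈1 col m11≈±1 =
    inj₁ (1 , ℕ.≤-refl , s≤s (s≤s (s≤s z≤n)) ,
      ≈±-trans (≈⇒≈± (α¹ X)) (blockColumn-m11 (αX-βY-inverse XY≈1) (blockColumn-step p col) m11≈±1))
  corner≈±1⇒WindowOutcome 0≉1 {w = _ ∷ _ ∷ w} (x≈ ∷ y≈ ∷ z≈ ∷ p@(_ ∷ _)) XY≈1 col m11≈±1 =
    WindowOutcome-block {length w} (corner≈±1⇒WindowOutcome 0≉1 p (αX-βY-inverse XY≈1)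
      (blockColumn-step (x≈ ∷ y≈ ∷ z≈ ∷ []) col) m11≈±1)

  trinomial-firstColumn : ∀ j {A X} → FirstColumn A X 0# → FirstColumn (Mat-acc A (trinomial u v j)) (α ^ j * X) 0#
  trinomial-firstColumn zero    col = FirstColumn-cong col (sym (*-identityˡ _)) refl
  trinomial-firstColumn (suc j) {X = X} col =
    FirstColumn-cong (trinomial-firstColumn j (inverse-pair-block refl refl uv≈1 col))
      (solve 3 (λ a p X → p :* (a :* X) := (a :* p) :* X) refl α (α ^ j) X) refl

  Mₙ-trinomial-firstColumn : ∀ j → FirstColumn (Mₙ (trinomial u v j)) (α ^ j) 0#
  Mₙ-trinomial-firstColumn j = FirstColumn-cong (trinomial-firstColumn j (column refl refl)) (*-identityʳ _) refl

  trinomial-solution⇒α^k≈±1 : ∀ k → IsSolution (trinomial u v k) → α ^ k ≈± 1#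
  trinomial-solution⇒α^k≈±1 k solution =
    ≈±-trans (≈⇒≈± (sym (m11≈ (Mₙ-trinomial-firstColumn k)))) (IsSolution⇒m11≈±1 (trinomial u v k) solution)

  vv-trinomial-m11 : ∀ j {A X Y} → BlockColumn second X Y A →
    m11 (Mat-acc A (v ∷ v ∷ trinomial u v j)) ≈ v * (v * (β ^ j * Y)) - α ^ j * X
  vv-trinomial-m11 zero {X = X} {Y} col = trans (m11≈ (second-two-letters refl refl col))
    (+-cong (*-congˡ (*-congˡ (sym (*-identityˡ Y)))) (-‿cong (sym (*-identityˡ X))))
  vv-trinomial-m11 (suc j) {X = X} {Y} col =
    trans (vv-trinomial-m11 j (blockColumn-step {second} (refl ∷ refl ∷ refl ∷ []) col))
      (solve 7 (λ v b q Y a p X →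
         v :* (v :* (q :* (b :* Y))) :- p :* (a :* X) := v :* (v :* ((b :* q) :* Y)) :- (a :* p) :* X)
       refl v β (β ^ j) Y α (α ^ j) X)

  Periodic-++ : ∀ {s m e w w'} → Periodic s m w → Periodic m e w' → Periodic s e (w ++ w')
  Periodic-++ []      p' = p'
  Periodic-++ (x≈ ∷ p) p' = x≈ ∷ Periodic-++ p p'

  Periodic-split : ∀ n {s e w} → Periodic s e w → ∃ λ m → Periodic s m (take n w) × Periodic m e (drop n w)
  Periodic-split zero    {s} p        = s , [] , p
  Periodic-split (suc n) {s} []       = s , [] , []
  Periodic-split (suc n) (x≈ ∷ p) with Periodic-split n p
  ... | m , p₁ , p₂ = m , x≈ ∷ p₁ , p₂

  Periodic-rotate : ∀ n {s w} → Periodic s s w → ∃ λ m → Periodic m m (rotate n w)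
  Periodic-rotate n p with Periodic-split n p
  ... | m , p₁ , p₂ = m , Periodic-++ p₂ p₁

  Periodic-≋ : ∀ {s e w w'} → Periodic s e w → w ≋ w' → Periodic s e w'
  Periodic-≋ []       []           = []
  Periodic-≋ (x≈ ∷ p) (x≈x' ∷ w≋w') = trans (sym x≈x') x≈ ∷ Periodic-≋ p w≋w'

  Periodic-suffix : ∀ w {s e w'} → Periodic s e (w ++ w') → ∃ λ m → Periodic m e w'
  Periodic-suffix []      {s} p       = s , p
  Periodic-suffix (x ∷ w) (_ ∷ p) = Periodic-suffix w p

  Periodic-trinomial : ∀ k → Periodic first first (trinomial u v k)
  Periodic-trinomial zero    = []
  Periodic-trinomial (suc k) = refl ∷ refl ∷ refl ∷ Periodic-trinomial k

  Periodic-reverse-trinomial : ∀ k → Periodic second second (reverse (trinomial u v k))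
  Periodic-reverse-trinomial zero    = []
  Periodic-reverse-trinomial (suc k) =
    ≡.subst (Periodic second second) (≡.sym (List.reverse-++ (u ∷ v ∷ v ∷ []) (trinomial u v k)))
      (Periodic-++ (Periodic-reverse-trinomial k) (refl ∷ refl ∷ refl ∷ []))

  trinomial-∼-periodic : ∀ k {cs} → trinomial u v k ∼ cs → ∃ λ s → Periodic s s cs
  trinomial-∼-periodic k (n , inj₁ rotate≋) with Periodic-rotate n (Periodic-trinomial k)
  ... | m , p = m , Periodic-≋ p rotate≋
  trinomial-∼-periodic k (n , inj₂ rotate≋) with Periodic-rotate n (Periodic-reverse-trinomial k)
  ... | m , p = m , Periodic-≋ p rotate≋

  length-trinomial : ∀ k → length (trinomial u v k) ≡.≡ 3 ℕ.* k
  length-trinomial zero    = ≡.refl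
  length-trinomial (suc k) = ≡.trans (≡.cong (3 ℕ.+_) (length-trinomial k)) (≡.sym (ℕ.*-suc 3 k))

  -- The window is the inner part of the solution b in c ∼ a ⊕ b.
  reducible⇒window : ∀ k → Reducible (trinomial u v k) →
    ∃₂ λ s e → ∃₂ λ x w → Periodic s e (x ∷ w) × length (x ∷ w) ℕ.+ 2 < 3 ℕ.* k × m11 (Mₙ (x ∷ w)) ≈± 1#
  reducible⇒window k (a₁ , amid , aₘ , b₁ , x ∷ w , bₗ , 1≤|amid| , _ , solution , t∼tuple)
    with trinomial-∼-periodic k t∼tuple
  ... | s , periodic with Periodic-suffix ((a₁ + bₗ) ∷ amid) periodic
  ... | m , (_ ∷ p) = next m , s , x , w , p , length-bound , solution⇒corner≈±1 b₁ (x ∷ w) bₗ solution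
    where
    open ℕ.≤-Reasoning
    n = length (x ∷ w)
    length-bound : n ℕ.+ 2 < 3 ℕ.* k
    length-bound = begin-strict
      n ℕ.+ 2                            ≡⟨ ℕ.+-comm n 2 ⟩
      1 ℕ.+ suc n                        ≤⟨ ℕ.+-monoˡ-≤ (suc n) 1≤|amid| ⟩
      length amid ℕ.+ suc n              <⟨ ℕ.n<1+n _ ⟩
      suc (length amid ℕ.+ suc n)        ≡⟨ ≡.cong suc (List.length-++ amid) ⟨
      length (⊕-tuple a₁ amid aₘ b₁ (x ∷ w) bₗ)   ≡⟨ ∼-length t∼tuple ⟩
      length (trinomial u v k)           ≡⟨ length-trinomial k ⟩
      3 ℕ.* k                            ∎

  trinomial-++ : ∀ a b → trinomial u v (a ℕ.+ b) ≡.≡ trinomial u v a ++ trinomial u v b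
  trinomial-++ zero    b = ≡.refl
  trinomial-++ (suc a) b = ≡.cong (λ w → u ∷ v ∷ v ∷ w) (trinomial-++ a b)

  -- X = (v·y - 1)/2 where y² = u² + 4, so that (2X + 1)² = v²y² = 1 + 4v².
  root-from-square : ∀ {t} → (1# + 1#) * t ≈ 1# → IsSquare (u * u + four) → ∃ λ X → X * X + X ≈ v * v
  root-from-square {t} 2t≈1 (y , y²≈u²+4) = X ,
    ≈-modulo (v * v * ((1# + 1#) * t + 1#) - t * (v * y - 1#)) 2t≈1
      (≈-modulo (t * t * (u * v + 1#)) uv≈1 (≈-modulo (t * t * (v * v)) y²≈u²+4 (solve 4 (λ u v y t →
        ((v :* y :- 1ₚ) :* t) :* ((v :* y :- 1ₚ) :* t) :+ (v :* y :- 1ₚ) :* t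
        := ((v :* v :+ ((1ₚ :+ 1ₚ) :* t :- 1ₚ) :* (v :* v :* ((1ₚ :+ 1ₚ) :* t :+ 1ₚ) :- t :* (v :* y :- 1ₚ)))
              :+ (u :* v :- 1ₚ) :* (t :* t :* (u :* v :+ 1ₚ)))
              :+ (y :* y :- (u :* u :+ (1ₚ :+ 1ₚ :+ 1ₚ :+ 1ₚ))) :* (t :* t :* (v :* v)))
        refl u v y t)))
    where X = (v * y - 1#) * t

  root≉0 : ¬ 0# ≈ 1# → ∀ {X} → X * X + X ≈ v * v → ¬ X ≈ 0#
  root≉0 0≉1 {X} root X≈0 = 0≉1 (sym (trans 1≈u²[X²+X] (trans (*-congˡ X²+X≈0) (zeroʳ _))))
    where
    1≈u²[X²+X] : 1# ≈ u * u * (X * X + X)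
    1≈u²[X²+X] = ≈-modulo (- (u * v + 1#)) uv≈1 (≈-modulo (- (u * u)) root (solve 3 (λ u v X →
      1ₚ := (u :* u :* (X :* X :+ X) :+ (u :* v :- 1ₚ) :* (:- (u :* v :+ 1ₚ)))
              :+ ((X :* X :+ X) :- v :* v) :* (:- (u :* u))) refl u v X))
    X²+X≈0 : X * X + X ≈ 0#
    X²+X≈0 = trans (+-cong (*-cong X≈0 X≈0) X≈0) (solve 0 (0ₚ :* 0ₚ :+ 0ₚ := 0ₚ) refl)

  corner-from-quadratic : ∀ {X Y δ} → X * Y ≈ 1# → X * X + δ * X ≈ v * v → v * (v * Y) - X ≈ δ
  corner-from-quadratic {X} {Y} {δ} XY≈1 quadratic =
    ≈-modulo (X + δ) XY≈1 (≈-modulo (- Y) quadratic (solve 4 (λ X Y δ v →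
      v :* (v :* Y) :- X := (δ :+ (X :* Y :- 1ₚ) :* (X :+ δ)) :+ ((X :* X :+ δ :* X) :- v :* v) :* (:- Y))
      refl X Y δ v))

  corner-from-root : ∀ {X X' Y'} → X' * Y' ≈ 1# → X' ≈± X → X * X + X ≈ v * v → v * (v * Y') - X' ≈± 1#
  corner-from-root {X} {X'} X'Y'≈1 (inj₁ X'≈X) root = inj₁ (corner-from-quadratic X'Y'≈1
    (trans (+-cong (*-cong X'≈X X'≈X) (trans (*-identityˡ X') X'≈X)) root))
  corner-from-root {X} {X'} X'Y'≈1 (inj₂ X'≈-X) root = inj₂ (corner-from-quadratic X'Y'≈1
    (trans (+-cong (*-cong X'≈-X X'≈-X) (*-congˡ X'≈-X))
      (trans (solve 1 (λ X → (:- X) :* (:- X) :+ (:- 1ₚ) :* (:- X) := X :* X :+ X) refl X) root)))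

  root-beside-period : ∀ {X j} → α ^ suc j ≈± 1# → α ^ j ≈± X → X * X + X ≈ v * v → X ≈ 0#
  root-beside-period {X} {j} αʲ⁺¹≈±1 αʲ≈±X root =
    ≈-modulo (- 1#) X²≈v² (≈-modulo 1# root (solve 2 (λ X v →
      X := (0ₚ :+ (X :* X :- v :* v) :* (:- 1ₚ)) :+ ((X :* X :+ X) :- v :* v) :* 1ₚ) refl X v))
    where
    αX≈±1 : α * X ≈± 1#
    αX≈±1 = ≈±-trans (≈±-*-congˡ α (≈±-sym αʲ≈±X)) αʲ⁺¹≈±1
    X²≈v² : X * X ≈ v * v
    X²≈v² = trans (≈-modulo (- ((u * v + 1#) * (X * X))) uv≈1 (solve 3 (λ u v X →
        X :* X := v :* v :* (((:- u) :* X) :* ((:- u) :* X)) :+ (u :* v :- 1ₚ) :* (:- ((u :* v :+ 1ₚ) :* (X :* X))))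
        refl u v X))
      (trans (*-congˡ (≈±1⇒*-self≈1 αX≈±1)) (*-identityʳ _))

  -- (u v v)ᵏ = u · (v v (u v v)ⁿ) · u · (v v (u v v)ʲ), and the last factor extends to a solution.
  reducible-from-root : ∀ {X j k} → α ^ j ≈± X → X * X + X ≈ v * v → 2 ℕ.+ j ≤ k → Reducible (trinomial u v k)
  reducible-from-root {X} {j} {k} αʲ≈±X root 2+j≤k =
    u - bₗ , amid , u - b₁ , b₁ , bmid , bₗ , s≤s z≤n , s≤s z≤n , corner≈±1⇒solution bmid corner , 0 , inj₁ rotation
    where
    n = k ℕ.∸ (2 ℕ.+ j)
    amid = v ∷ v ∷ trinomial u v n
    bmid = v ∷ v ∷ trinomial u v j
    N = Mₙ bmid
    b₁ = - (m11 N * m12 N)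
    bₗ = m11 N * m21 N
    corner : m11 N ≈± 1#
    corner = ≈±-trans (≈⇒≈± (vv-trinomial-m11 j (BlockColumn-start second)))
      (corner-from-root (trans (*-cong (*-identityʳ _) (*-identityʳ _)) (^-inverse αβ≈1 j))
        (≈±-trans (≈⇒≈± (*-identityʳ _)) αʲ≈±X) root)
    split : rotate 0 (trinomial u v k) ≡.≡ u ∷ amid ++ u ∷ bmid
    split = ≡.trans (List.++-identityʳ _) (≡.trans (≡.cong (trinomial u v)
      (≡.trans (≡.sym (ℕ.m∸n+n≡m 2+j≤k)) (ℕ.+-suc n (suc j)))) (trinomial-++ (suc n) (suc j)))
    x≈x-y+y : ∀ x y → x ≈ (x - y) + y
    x≈x-y+y = solve 2 (λ x y → x := (x :- y) :+ y) refl
    rotation : rotate 0 (trinomial u v k) ≋ ⊕-tuple (u - bₗ) amid (u - b₁) b₁ bmid bₗ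
    rotation = ≡.subst (_≋ ⊕-tuple (u - bₗ) amid (u - b₁) b₁ bmid bₗ) (≡.sym split)
      (x≈x-y+y u bₗ ∷ Pointwise.++⁺ {ws = amid} (Pointwise.refl refl) (x≈x-y+y u b₁ ∷ Pointwise.refl refl))

  power-of-generator : IsGenerator u ⊎ IsGenerator (- u) → ∀ {X} → ¬ X ≈ 0# → ∃ λ i → α ^ i ≈± X
  power-of-generator (inj₁ (_ , generates)) X≉0 with generates _ X≉0
  ... | i , uⁱ≈X = i , ≈±-trans (-^≈±^ u i) (≈⇒≈± uⁱ≈X)
  power-of-generator (inj₂ (_ , generates)) X≉0 with generates _ X≉0
  ... | i , αⁱ≈X = i , ≈⇒≈± αⁱ≈X

  root-power⇒reducible : ¬ 0# ≈ 1# → ∀ {X j k} → α ^ suc k ≈± 1# → X * X + X ≈ v * v → j < suc k → α ^ j ≈± X →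
    Reducible (trinomial u v (suc k))
  root-power⇒reducible 0≉1 {j = j} αᵏ≈±1 root j<k αʲ≈±X with ℕ.m≤n⇒m<n∨m≡n j<k
  ... | inj₁ 2+j≤k = reducible-from-root αʲ≈±X root 2+j≤k
  ... | inj₂ ≡.refl = ⊥-elim (root≉0 0≉1 root (root-beside-period {j = j} αᵏ≈±1 αʲ≈±X root))

  generator-root⇒reducible : ¬ 0# ≈ 1# → IsGenerator u ⊎ IsGenerator (- u) → ∀ {X k} → α ^ suc k ≈± 1# →
    X * X + X ≈ v * v → Reducible (trinomial u v (suc k))
  generator-root⇒reducible 0≉1 generator {k = k} αᵏ≈±1 root =
    let (i , αⁱ≈±X) = power-of-generator generator (root≉0 0≉1 root) in
    root-power⇒reducible 0≉1 αᵏ≈±1 root (ℕ.m%n<n i (suc k)) (≈±-trans (^-%-≈± (suc k) αᵏ≈±1 i) αⁱ≈±X)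


module FiniteFieldTrinomials {c ℓ} (K : CommutativeRing c ℓ) (F : IsFiniteField K) {u v : CommutativeRing.Carrier K}
  (uv≈1 : CommutativeRing._≈_ K (CommutativeRing._*_ K u v) (CommutativeRing.1# K))
  (u≉1 : ¬ CommutativeRing._≈_ K u (CommutativeRing.1# K))
  (u≉-1 : ¬ CommutativeRing._≈_ K u (CommutativeRing.-_ K (CommutativeRing.1# K))) where

  open CommutativeRing K
  open IsFiniteField F
  open FF K
  open M2 using (m11; m12; m21; m22)
  open Signs K
  open Matrices K
  open Trinomials K uv≈1
  open IntegerCoefficientSolver K using (solve; _:=_; _:+_; _:*_; :-_; _:-_; 0ₚ; 1ₚ)
  open import Algebra.Properties.Group +-group using (x∙y⁻¹≈ε⇒x≈y; ⁻¹-injective)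
  open import Relation.Binary.Reasoning.Setoid setoid

  *-cancelʳ-≉0 : ∀ {d z} → ¬ d ≈ 0# → z * d ≈ 0# → z ≈ 0#
  *-cancelʳ-≉0 {d} {z} d≉0 zd≈0 with inverse d d≉0
  ... | d⁻¹ , dd⁻¹≈1 = begin
    z               ≈⟨ *-identityʳ z ⟨
    z * 1#          ≈⟨ *-congˡ dd⁻¹≈1 ⟨
    z * (d * d⁻¹)   ≈⟨ *-assoc z d d⁻¹ ⟨
    (z * d) * d⁻¹   ≈⟨ *-congʳ zd≈0 ⟩
    0# * d⁻¹        ≈⟨ zeroˡ d⁻¹ ⟩
    0#              ∎

  α-β≉0 : ¬ α - β ≈ 0#
  α-β≉0 α-β≈0 = u≉-1 (x∙y⁻¹≈ε⇒x≈y u (- 1#) (*-cancelʳ-≉0 u-1≉0 (≈-modulo 1# u²≈1 (solve 1 (λ u →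
    (u :- (:- 1ₚ)) :* (u :- 1ₚ) := 0ₚ :+ (u :* u :- 1ₚ) :* 1ₚ) refl u))))
    where
    u-1≉0 : ¬ u - 1# ≈ 0#
    u-1≉0 u-1≈0 = u≉1 (x∙y⁻¹≈ε⇒x≈y u 1# u-1≈0)
    u²≈1 : u * u ≈ 1#
    u²≈1 = trans (*-congˡ (⁻¹-injective (x∙y⁻¹≈ε⇒x≈y α β α-β≈0))) uv≈1

  commuting⇒m12≈0 : ∀ {M B} → (M ⊗ B) ≈M (B ⊗ M) → m11 M ≈ m22 M → ¬ m11 B - m22 B ≈ 0# → m12 M ≈ 0#
  commuting⇒m12≈0 {M} {B} (_ , MB≈BM , _) m11≈m22 B₁₁-B₂₂≉0 = *-cancelʳ-≉0 B₁₁-B₂₂≉0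
    (≈-modulo (m12 B) m11≈m22 (≈-modulo (- 1#) MB≈BM (solve 7 (λ a b d p q s z →
      z :* (p :- s) := (0ₚ :+ (a :- d) :* q) :+ ((a :* q :+ z :* s) :- (p :* z :+ q :* d)) :* (:- 1ₚ))
      refl (m11 M) (m21 M) (m22 M) (m11 B) (m12 B) (m22 B) (m12 M))))

  -- Mₙ(t j) commutes with the block Mₙ(t 1), whose diagonal entries α ≠ β differ, so it is scalar.
  trinomial-solution : ∀ j → α ^ j ≈± 1# → IsSolution (trinomial u v j)
  trinomial-solution j αʲ≈±1 = scalar⇒IsSolution (trinomial u v j) (refl , M₁₂≈0 , m21≈ colM , M₂₂≈M₁₁) M₁₁≈±1
    where
    M = Mₙ (trinomial u v j)
    B = Mₙ (trinomial u v 1)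
    colM = Mₙ-trinomial-firstColumn j
    colB = Mₙ-trinomial-firstColumn 1
    M₁₁≈±1 : m11 M ≈± 1#
    M₁₁≈±1 = ≈±-trans (≈⇒≈± (m11≈ colM)) αʲ≈±1
    M₂₂≈M₁₁ : m22 M ≈ m11 M
    M₂₂≈M₁₁ = ≈±1-inverse (det≈1⇒m11*m22≈1 (det-Mₙ (trinomial u v j)) (m21≈ colM)) M₁₁≈±1
    B₁₁≈α : m11 B ≈ α
    B₁₁≈α = trans (m11≈ colB) (*-identityʳ α)
    B₂₂≈β : m22 B ≈ β
    B₂₂≈β = *-inverse-unique
      (trans (*-congʳ (sym B₁₁≈α)) (det≈1⇒m11*m22≈1 (det-Mₙ (trinomial u v 1)) (m21≈ colB))) αβ≈1
    tⱼ++t₁≡t₁++tⱼ : trinomial u v j ++ trinomial u v 1 ≡.≡ trinomial u v 1 ++ trinomial u v j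
    tⱼ++t₁≡t₁++tⱼ = ≡.trans (≡.sym (trinomial-++ j 1))
      (≡.trans (≡.cong (trinomial u v) (ℕ.+-comm j 1)) (trinomial-++ 1 j))
    commute : (M ⊗ B) ≈M (B ⊗ M)
    commute = ≈M-trans (≈M-sym (Mₙ-++ (trinomial u v 1) (trinomial u v j)))
      (≡.subst (λ w → Mₙ w ≈M (B ⊗ M)) tⱼ++t₁≡t₁++tⱼ (Mₙ-++ (trinomial u v j) (trinomial u v 1)))
    M₁₂≈0 : m12 M ≈ 0#
    M₁₂≈0 = commuting⇒m12≈0 commute (sym M₂₂≈M₁₁)
      (λ B₁₁-B₂₂≈0 → α-β≉0 (trans (+-cong (sym B₁₁≈α) (-‿cong (sym B₂₂≈β))) B₁₁-B₂₂≈0))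

  nonsquare⇒irreducible : ¬ IsSquare (u * u + four) → ∀ k → IsMinimalTrinomial u v k → Irreducible (trinomial u v k)
  nonsquare⇒irreducible ¬square k (_ , _ , minimal) reducible with reducible⇒window k reducible
  ... | s , _ , _ , _ , periodic , short , corner
    with corner≈±1⇒WindowOutcome 0≉1 periodic (*-identityʳ 1#) (BlockColumn-start s) corner
  ... | inj₂ square = ¬square square
  ... | inj₁ (j , 1≤j , 3j≤n+2 , αʲ≈±1) = ℕ.<⇒≱ j<k (minimal j 1≤j (trinomial-solution j αʲ≈±1′))
    where
    j<k = ℕ.*-cancelˡ-< 3 j k (ℕ.≤-<-trans 3j≤n+2 short)
    αʲ≈±1′ = ≈±-trans (≈⇒≈± (sym (*-identityʳ _))) αʲ≈±1

  square⇒reducible : ¬ 1# + 1# ≈ 0# → IsGenerator u ⊎ IsGenerator (- u) → ∀ k → IsMinimalTrinomial u v k →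
    IsSquare (u * u + four) → Reducible (trinomial u v k)
  square⇒reducible 2≉0 generator (suc k) (_ , solution , _) square =
    generator-root⇒reducible 0≉1 generator (trinomial-solution⇒α^k≈±1 (suc k) solution)
      (proj₂ (root-from-square (proj₂ (inverse (1# + 1#) 2≉0)) square))

theorem6p4 : ∀ {c ℓ} (K : CommutativeRing c ℓ) → IsFiniteField K →
  ¬ (CommutativeRing._≈_ K (CommutativeRing._+_ K (CommutativeRing.1# K) (CommutativeRing.1# K)) (CommutativeRing.0# K)) →
  (u v : CommutativeRing.Carrier K) →
  CommutativeRing._≈_ K (CommutativeRing._*_ K u v) (CommutativeRing.1# K) →
  ¬ (CommutativeRing._≈_ K u (CommutativeRing.0# K)) →
  ¬ (CommutativeRing._≈_ K u (CommutativeRing.1# K)) →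
  ¬ (CommutativeRing._≈_ K u (CommutativeRing.-_ K (CommutativeRing.1# K))) →
  (¬ FF.IsSquare K (CommutativeRing._+_ K (CommutativeRing._*_ K u u) (FF.four K)) →
    ∀ (k : ℕ) → FF.IsMinimalTrinomial K u v k → FF.Irreducible K (FF.trinomial K u v k))
  ×
  ((FF.IsGenerator K u ⊎ FF.IsGenerator K (CommutativeRing.-_ K u)) →
    ∀ (k : ℕ) → FF.IsMinimalTrinomial K u v k →
      (FF.Irreducible K (FF.trinomial K u v k) ⇔ (¬ FF.IsSquare K (CommutativeRing._+_ K (CommutativeRing._*_ K u u) (FF.four K)))))
theorem6p4 K F 2≉0 u v uv≈1 _ u≉1 u≉-1 =   -- u ≉ 0 already follows from uv ≈ 1
  nonsquare⇒irreducible ,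
  λ generator k minimal → mk⇔
    (λ irreducible square → irreducible (square⇒reducible 2≉0 generator k minimal square))
    (λ ¬square → nonsquare⇒irreducible ¬square k minimal)
  where open FiniteFieldTrinomials K F uv≈1 u≉1 u≉-1
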